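{- The map $\mathfrak W_n:\mathrm{VHC}(\mathrm{Av}_n(132))\to\mathrm{VHC}(\mathrm{Av}_n(312))$, $\mathfrak W_n(\tau,V)=(\mathrm{swl}(\tau),\{\mathrm{nw}(\mathrm{swl}(A)):A\in V\})$, is injective.
   Context: For $\pi\in S_n$ with plot $\{(i,\pi_i)\}$: $(i,\pi_i)$ is a descent top if $i<n$, $\pi_i>\pi_{i+1}$. A hook from $(i,\pi_i)$ to $(j,\pi_j)$ ($i<j$, $\pi_i<\pi_j$) is the vertical segment from $(i,\pi_i)$ to $(i,\pi_j)$ then horizontal to $(j,\pi_j)$ (southwest/northeast endpoints). A valid hook configuration (VHC) on $\pi$ is a set of hooks with (i) southwest endpoints exactly the descent tops; (ii) for each hook from $(i,\pi_i)$ to $(j,\pi_j)$ no $k$ with $i<k<j$, $\pi_k>\pi_j$; (iii) hooks meeting only at endpoints; it is written $(\pi,V)$ with $V$ its set of northeast endpoints. $\pi$ avoids $132$ (resp. $312$) if there are no $a<b<c$ with $\pi_a<\pi_c<\pi_b$ (resp. $\pi_b<\pi_c<\pi_a$); $\mathrm{VHC}(\mathrm{Av}_n(\sigma))$ is the set of VHCs on $\sigma$-avoiding permutations in $S_n$. For $i\in[n]$ let $(m,\pi_m)$ be the point with $\pi_m=i$, $B$ (resp. $T$) the subsequence of $\pi_1\cdots\pi_{m-1}$ of entries $<i$ (resp. $>i$), $\mathrm{swl}_i(\pi)=B\,T\,\pi_m\cdots\pi_n$, and $\mathrm{swl}=\mathrm{swl}_1\circ\cdots\circ\mathrm{swl}_n$;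 $\mathrm{swl}$ maps $\mathrm{Av}_n(132)$ bijectively onto $\mathrm{Av}_n(312)$. The image $\mathrm{swl}(p)$ of a point $p$ of height $h$ is the point of height $h$ in the image permutation. A left-to-right maximum is a point with no strictly higher point to its left. For $312$-avoiding $\pi$, $\mathrm{nw}(i,\pi_i)$ is the leftmost left-to-right maximum $(j,\pi_j)$ with $j\leq i$ and $\pi_j\ge\pi_i$. (The image of $\mathfrak W_n$ is indeed a VHC.) -}

module Defs where

import Data.Nat
import Relation.Nullary
open import Data.Nat using (ℕ; zero; suc; _+_; _*_; _∸_; _≤_; _<_; _>_; _≤ᵇ_)
open import Data.Bool using (Bool; true; false; _∧_; if_then_else_)
open import Data.List using (List; []; _∷_; _++_; map; filter; length; upTo)
open import Data.Bool.ListAction using (all)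
open import Data.List.Membership.Propositional using (_∈_)
open import Data.List.Relation.Binary.Permutation.Propositional using (_↭_)
open import Data.Product using (_×_; _,_; ∃; proj₁; proj₂)
open import Data.Sum using (_⊎_)
open import Relation.Binary.PropositionalEquality using (_≡_; _≢_)
open import Relation.Nullary using (¬_)
open import Function.Bundles using (_⇔_)
open import Data.Nat.Properties using (_<?_)

-- Permutations of [n] in one-line notation: a list of values 1..n.
-- Positions are 1-indexed:  π ⟨ i ⟩  is π_i  (default 0 out of range).
_⟨_⟩ : List ℕ → ℕ → ℕ
[]      ⟨ _ ⟩           = 0
(x ∷ π) ⟨ zero ⟩        = 0
(x ∷ π) ⟨ suc zero ⟩    = x
(x ∷ π) ⟨ suc (suc i) ⟩ = π ⟨ suc i ⟩

IsPerm : ℕ → List ℕ → Set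
IsPerm n π = π ↭ map suc (upTo n)

-- points of the plot are pairs (position , height)
Point : Set
Point = ℕ × ℕ

Avoids132 : List ℕ → Set
Avoids132 π = ∀ a b c → 1 ≤ a → a < b → b < c → c ≤ length π →
  ¬ (π ⟨ a ⟩ < π ⟨ c ⟩ × π ⟨ c ⟩ < π ⟨ b ⟩)

Avoids312 : List ℕ → Set
Avoids312 π = ∀ a b c → 1 ≤ a → a < b → b < c → c ≤ length π →
  ¬ (π ⟨ b ⟩ < π ⟨ c ⟩ × π ⟨ c ⟩ < π ⟨ a ⟩)

DescentTop : List ℕ → ℕ → Set
DescentTop π i = 1 ≤ i × i < length π × π ⟨ suc i ⟩ < π ⟨ i ⟩

-- a hook is given by the positions (i , j) of its southwest and northeast endpoints
Hook : Set
Hook = ℕ × ℕ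

ValidHook : List ℕ → Hook → Set
ValidHook π (i , j) = 1 ≤ i × i < j × j ≤ length π × π ⟨ i ⟩ < π ⟨ j ⟩ ×
  (∀ k → i < k → k < j → ¬ (π ⟨ j ⟩ < π ⟨ k ⟩))

-- Geometry of hooks, in doubled coordinates (so that any overlap of positive
-- length between two segments contains a lattice point that is not an endpoint).
OnHook : List ℕ → Hook → ℕ × ℕ → Set
OnHook π (i , j) (x , y) =
  (x ≡ 2 * i × 2 * π ⟨ i ⟩ ≤ y × y ≤ 2 * π ⟨ j ⟩)
  ⊎ (y ≡ 2 * π ⟨ j ⟩ × 2 * i ≤ x × x ≤ 2 * j)

IsEndpoint : List ℕ → Hook → ℕ × ℕ → Set
IsEndpoint π (i , j) p = p ≡ (2 * i , 2 * π ⟨ i ⟩) ⊎ p ≡ (2 * j , 2 * π ⟨ j ⟩)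

record IsVHC (π : List ℕ) (H : List Hook) : Set where
  field
    valid     : ∀ h → h ∈ H → ValidHook π h
    swDescent : ∀ i → DescentTop π i ⇔ ∃ λ j → (i , j) ∈ H
    meetEnds  : ∀ h h' → h ∈ H → h' ∈ H → h ≢ h' → ∀ p →
                OnHook π h p → OnHook π h' p → IsEndpoint π h p × IsEndpoint π h' p

record VHC132 (n : ℕ) : Set where
  field
    perm    : List ℕ
    hooks   : List Hook
    isPerm  : IsPerm n perm
    avoids  : Avoids132 perm
    isVHC   : IsVHC perm hooks

NE : List ℕ → List Hook → List Point
NE π H = map (λ h → (proj₂ h , π ⟨ proj₂ h ⟩)) H

-- position (1-indexed) of the value v in π  (0 if absent)
posOf : List ℕ → ℕ → ℕ
posOf []      v = 0
posOf (x ∷ π) v with x Data.Nat.≟ v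
... | Relation.Nullary.yes _ = 1
... | Relation.Nullary.no  _ = suc (posOf π v)

splitAt : ℕ → List ℕ → List ℕ × List ℕ
splitAt i [] = [] , []
splitAt i (x ∷ π) with x Data.Nat.≟ i
... | Relation.Nullary.yes _ = [] , x ∷ π
... | Relation.Nullary.no  _ = x ∷ proj₁ (splitAt i π) , proj₂ (splitAt i π)

swlᵢ : ℕ → List ℕ → List ℕ
swlᵢ i π = filter (_<? i) (proj₁ (splitAt i π))
        ++ filter (i <?_) (proj₁ (splitAt i π))
        ++ proj₂ (splitAt i π)

swlUpTo : ℕ → List ℕ → List ℕ
swlUpTo zero    π = π
swlUpTo (suc k) π = swlUpTo k (swlᵢ (suc k) π)

swl : List ℕ → List ℕ
swl π = swlUpTo (length π) π

swlPt : List ℕ → Point → Point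
swlPt σ (_ , h) = (posOf σ h , h)

isLRmax : List ℕ → ℕ → Bool
isLRmax σ j = all (λ k → σ ⟨ k ⟩ ≤ᵇ σ ⟨ j ⟩) (map suc (upTo (j ∸ 1)))

firstNW : List ℕ → ℕ → ℕ → List ℕ → ℕ
firstNW σ v d []      = d
firstNW σ v d (j ∷ js) = if isLRmax σ j ∧ (v ≤ᵇ σ ⟨ j ⟩) then j else firstNW σ v d js

nw : List ℕ → Point → Point
nw σ (i , _) = let j = firstNW σ (σ ⟨ i ⟩) i (map suc (upTo i)) in (j , σ ⟨ j ⟩)

𝔚 : ∀ {n} → VHC132 n → List ℕ × List Point
𝔚 c = swl τ , map (λ A → nw (swl τ) (swlPt (swl τ) A)) (NE τ (VHC132.hooks c))
  where τ = VHC132.perm c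

_≈ᴾ_ : List ℕ × List Point → List ℕ × List Point → Set
(σ , P) ≈ᴾ (σ' , P') = σ ≡ σ' × (∀ p → (p ∈ P) ⇔ (p ∈ P'))

_≈ᵛ_ : ∀ {n} → VHC132 n → VHC132 n → Set
c ≈ᵛ c' = VHC132.perm c ≡ VHC132.perm c' ×
          (∀ h → (h ∈ VHC132.hooks c) ⇔ (h ∈ VHC132.hooks c'))

module Submission where

-- (1) swl is injective on Av_n(132) (swl-injective).  By induction on n:
--     swl_n fixes a permutation of [n] and deleting n commutes with swl_i
--     for i < n (del-swl), so swl τ = swl τ' forces τ∖n = τ'∖n.  If n sits
--     at different places, τ = α n G β and τ' = α G n β with G ≠ [] and
--     k = max G: swl never reverses the ascent k … n of τ', and, by
--     132-avoidance of τ', it does not reverse the descent n … k of τ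
--     either (moving-max-changes-swl).  Both facts come from one
--     order-preservation property of a single step (swlᵢ-preserves-order).
-- (2) The hooks are determined by the image.  Write nwHeight v for the
--     height of nw applied to the point of height v of σ = swl τ.  An
--     ascent w, w+1 of τ makes w a left-to-right maximum of σ; hence if
--     v < c have the same nwHeight, then c, c-1, …, v occur in τ from left
--     to right (tied⇒descending).  Two VHCs on τ with the same image are
--     compared by downward induction on the southwest endpoint i of their
--     hooks: hooks (i,J), (i,J') with J' < J contradict 132-avoidance,
--     condition (ii) or the non-crossing condition (iii) (NoShorterHook,
--     Agreement).

open import Defs
open import Data.Nat using (ℕ; zero; suc; _*_; _∸_; _≤_; _<_; _≤ᵇ_; z≤n; s≤s; _≟_)
open import Data.Nat.Properties
open import Data.Bool using (true; false; T; _∧_)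
open import Data.Bool.Properties using (T-∧)
open import Data.List using (List; []; _∷_; _++_; map; filter; length; upTo; [_])
open import Data.List.Properties
  using (∷-injective; filter-all; filter-none; filter-accept; filter-reject; filter-++; map-++; map-upTo; length-map; length-upTo; upTo-∷ʳ; ++-assoc; ++-identityʳ)
open import Data.List.Extrema.Nat using (max; argmax-sel; ⊥≤max; xs≤max)
open import Data.List.Membership.Propositional using (_∈_; _∉_)
open import Data.List.Membership.Propositional.Properties
  using (∈-∃++; ∈-filter⁺; ∈-filter⁻; ∈-map⁺; ∈-map⁻; ∈-++⁺ˡ; ∈-++⁺ʳ; ∈-++⁻; ∈-upTo⁺; ∈-upTo⁻)
open import Data.List.Relation.Unary.Any using (here; there)
open import Data.List.Relation.Unary.All as All using (All; []; _∷_)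
open import Data.List.Relation.Unary.All.Properties using (all⁻)
open import Data.List.Relation.Unary.AllPairs using (AllPairs; []; _∷_)
open import Data.List.Relation.Unary.AllPairs.Properties using (applyUpTo⁺₁)
open import Data.List.Relation.Unary.Unique.Propositional {A = ℕ} using (Unique)
open import Data.List.Relation.Unary.Unique.Propositional.Properties
  using (Unique[x∷xs]⇒x∉xs; upTo⁺) renaming (map⁺ to Unique-map⁺)
open import Data.List.Relation.Binary.Sublist.Propositional {A = ℕ}
  using (_⊆_; []; _∷_; _∷ʳ_; ⊆-refl; ⊆-trans; minimum; to∈; from∈)
open import Data.List.Relation.Binary.Sublist.Propositional.Properties
  using (∷ˡ⁻; All-resp-⊆; filter⁺)
  renaming (++⁺ to ⊆-++⁺; ++⁺ˡ to ⊆-++ˡ; ++⁺ʳ to ⊆-++ʳ)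
open import Data.List.Relation.Binary.Permutation.Propositional {A = ℕ}
  using (_↭_; ↭-refl; prep; ↭-sym; ↭-trans; ↭⇒↭ₛ; module PermutationReasoning)
open import Data.List.Relation.Binary.Permutation.Propositional.Properties
  using (∈-resp-↭; shift; ++⁺ʳ; drop-mid; ↭-empty-inv; ↭-length)
open import Relation.Binary.PropositionalEquality using (setoid)
open import Data.List.Relation.Binary.Permutation.Setoid.Properties (setoid ℕ) using (Unique-resp-↭)
open import Data.Product using (_×_; _,_; ∃; proj₁; proj₂)
import Data.Product as Product
open import Data.Sum using (_⊎_; inj₁; inj₂)
open import Data.Empty using (⊥; ⊥-elim)
open import Relation.Nullary using (¬_; yes; no; Dec; ¬?)
open import Relation.Unary using (Decidable)
open import Relation.Binary.Definitions using (Tri; tri<; tri≈; tri>)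
open import Relation.Binary.PropositionalEquality
  using (_≡_; _≢_; refl; sym; trans; cong; cong₂; subst; subst₂; module ≡-Reasoning)
open import Function.Bundles using (_⇔_; mk⇔; Equivalence)

Precedes : List ℕ → ℕ → ℕ → Set
Precedes π x y = x ∷ y ∷ [] ⊆ π

head-∈ : ∀ {x xs ys} → x ∷ xs ⊆ ys → x ∈ ys
head-∈ s = to∈ (⊆-trans (refl ∷ minimum _) s)

later-∈ : ∀ {π x y} → Precedes π x y → y ∈ π
later-∈ s = head-∈ (∷ˡ⁻ s)

precedes-++ : ∀ {x y A B} → x ∈ A → y ∈ B → Precedes (A ++ B) x y
precedes-++ x∈A y∈B = ⊆-++⁺ (from∈ x∈A) (from∈ y∈B)

precedes-++⁻ : ∀ {x y} A {B} → Precedes (A ++ B) x y →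
  Precedes A x y ⊎ (x ∈ A × y ∈ B) ⊎ Precedes B x y
precedes-++⁻ [] s = inj₂ (inj₂ s)
precedes-++⁻ (a ∷ A) (_ ∷ʳ s) with precedes-++⁻ A s
... | inj₁ s' = inj₁ (a ∷ʳ s')
... | inj₂ (inj₁ (x∈A , y∈B)) = inj₂ (inj₁ (there x∈A , y∈B))
... | inj₂ (inj₂ s') = inj₂ (inj₂ s')
precedes-++⁻ (a ∷ A) (refl ∷ s) with ∈-++⁻ A (to∈ s)
... | inj₁ y∈A = inj₁ (refl ∷ from∈ y∈A)
... | inj₂ y∈B = inj₂ (inj₁ (here refl , y∈B))

⊆-filter : ∀ {P : ℕ → Set} (P? : Decidable P) {xs A} → xs ⊆ A → All P xs → xs ⊆ filter P? A
⊆-filter P? {xs} {A} s ps = subst (_⊆ filter P? A) (filter-all P? ps) (filter⁺ P? P? (λ { refl p → p }) s)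

unique-↭ : ∀ {xs ys} → xs ↭ ys → Unique xs → Unique ys
unique-↭ p = Unique-resp-↭ (↭⇒↭ₛ p)

unique-⊆ : ∀ {xs ys} → xs ⊆ ys → Unique ys → Unique xs
unique-⊆ [] [] = []
unique-⊆ (_ ∷ʳ s) (_ ∷ u) = unique-⊆ s u
unique-⊆ (refl ∷ s) (x∉ ∷ u) = All-resp-⊆ s x∉ ∷ unique-⊆ s u

unique-disjoint : ∀ {x} A {B} → Unique (A ++ B) → x ∈ A → x ∉ B
unique-disjoint (a ∷ A) u (here refl) x∈B = Unique[x∷xs]⇒x∉xs u (∈-++⁺ʳ A x∈B)
unique-disjoint (a ∷ A) (_ ∷ u) (there x∈A) x∈B = unique-disjoint A u x∈A x∈B

precedes-asym : ∀ {π x y} → Unique π → Precedes π x y → Precedes π y x → ⊥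
precedes-asym (_ ∷ u) (_ ∷ʳ s) (_ ∷ʳ t) = precedes-asym u s t
precedes-asym u (_ ∷ʳ s) (refl ∷ _) = Unique[x∷xs]⇒x∉xs u (later-∈ s)
precedes-asym u (refl ∷ _) (_ ∷ʳ t) = Unique[x∷xs]⇒x∉xs u (later-∈ t)
precedes-asym u (refl ∷ _) (refl ∷ t) = Unique[x∷xs]⇒x∉xs u (head-∈ t)

prefix : ℕ → List ℕ → List ℕ
prefix i π = proj₁ (splitAt i π)

suffix : ℕ → List ℕ → List ℕ
suffix i π = proj₂ (splitAt i π)

lower : ℕ → List ℕ → List ℕ
lower i = filter (_<? i)

upper : ℕ → List ℕ → List ℕ
upper i = filter (i <?_)

prefix++suffix : ∀ i π → prefix i π ++ suffix i π ≡ π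
prefix++suffix i [] = refl
prefix++suffix i (x ∷ π) with x ≟ i
... | yes _ = refl
... | no _ = cong (x ∷_) (prefix++suffix i π)

prefix-avoids : ∀ i π → All (_≢ i) (prefix i π)
prefix-avoids i [] = []
prefix-avoids i (x ∷ π) with x ≟ i
... | yes _ = []
... | no x≢i = x≢i ∷ prefix-avoids i π

suffix-shape : ∀ i π → suffix i π ≡ [] ⊎ ∃ λ R → suffix i π ≡ i ∷ R
suffix-shape i [] = inj₁ refl
suffix-shape i (x ∷ π) with x ≟ i
... | yes refl = inj₂ (π , refl)
... | no _ = suffix-shape i π

splitAt-head : ∀ i π → splitAt i (i ∷ π) ≡ ([] , i ∷ π)
splitAt-head i π with i ≟ i
... | yes _ = refl
... | no i≢i = ⊥-elim (i≢i refl)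

splitAt-other : ∀ {i x} π → x ≢ i → splitAt i (x ∷ π) ≡ (x ∷ prefix i π , suffix i π)
splitAt-other {i} {x} π x≢i with x ≟ i
... | yes x≡i = ⊥-elim (x≢i x≡i)
... | no _ = refl

lower++upper-↭ : ∀ i P → All (_≢ i) P → lower i P ++ upper i P ↭ P
lower++upper-↭ i [] _ = ↭-refl
lower++upper-↭ i (x ∷ P) (x≢i ∷ P≢i) with <-cmp x i
... | tri< x<i _ _ rewrite filter-accept (_<? i) {x} {P} x<i | filter-reject (i <?_) {x} {P} (<⇒≯ x<i) =
  prep x (lower++upper-↭ i P P≢i)
... | tri≈ _ x≡i _ = ⊥-elim (x≢i x≡i)
... | tri> _ _ i<x rewrite filter-reject (_<? i) {x} {P} (<⇒≯ i<x) | filter-accept (i <?_) {x} {P} i<x =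
  ↭-trans (shift x (lower i P) (upper i P)) (prep x (lower++upper-↭ i P P≢i))

swlᵢ-↭ : ∀ i π → swlᵢ i π ↭ π
swlᵢ-↭ i π = begin
  lower i P ++ upper i P ++ R   ≡⟨ ++-assoc (lower i P) (upper i P) R ⟨
  (lower i P ++ upper i P) ++ R ↭⟨ ++⁺ʳ R (lower++upper-↭ i P (prefix-avoids i π)) ⟩
  P ++ R                        ≡⟨ prefix++suffix i π ⟩
  π                             ∎
  where
  open PermutationReasoning
  P = prefix i π
  R = suffix i π

unique-swlᵢ : ∀ i {π} → Unique π → Unique (swlᵢ i π)
unique-swlᵢ i {π} = unique-↭ (↭-sym (swlᵢ-↭ i π))

∈-lower++upper : ∀ {i x P} → x ∈ P → x ≢ i → x ∈ lower i P ++ upper i P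
∈-lower++upper {i} {x} {P} x∈P x≢i with <-cmp x i
... | tri< x<i _ _ = ∈-++⁺ˡ (∈-filter⁺ (_<? i) x∈P x<i)
... | tri≈ _ x≡i _ = ⊥-elim (x≢i x≡i)
... | tri> _ _ i<x = ∈-++⁺ʳ (lower i P) (∈-filter⁺ (i <?_) x∈P i<x)

-- swl_i keeps "x before y" unless y < i < x with x in the prefix before i;
-- the latter is excluded as soon as i precedes x.
swlᵢ-preserves-order : ∀ {i π x y} → Unique π → Precedes π x y →
  (y < i → i < x → Precedes π i x) → Precedes (swlᵢ i π) x y
swlᵢ-preserves-order {i} {π} {x} {y} u x≺y guard = byLocation (precedes-++⁻ P (inPR x≺y))
  where
  P = prefix i π
  R = suffix i π
  P≢i = prefix-avoids i π
  inPR : ∀ {a b} → Precedes π a b → Precedes (P ++ R) a b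
  inPR {a} {b} = subst (λ ρ → Precedes ρ a b) (sym (prefix++suffix i π))
  -- Both entries in the prefix: they move apart only if x > i > y.
  inPrefix : Precedes P x y → Tri (x < i) (x ≡ i) (i < x) → Tri (y < i) (y ≡ i) (i < y) → Precedes (swlᵢ i π) x y
  inPrefix s (tri≈ _ x≡i _) _ = ⊥-elim (All.lookup P≢i (head-∈ s) x≡i)
  inPrefix s _ (tri≈ _ y≡i _) = ⊥-elim (All.lookup P≢i (later-∈ s) y≡i)
  inPrefix s (tri< x<i _ _) (tri< y<i _ _) = ⊆-++ʳ (upper i P ++ R) (⊆-filter (_<? i) s (x<i ∷ y<i ∷ []))
  inPrefix s (tri> _ _ i<x) (tri> _ _ i<y) = ⊆-++ˡ (lower i P) (⊆-++ʳ R (⊆-filter (i <?_) s (i<x ∷ i<y ∷ [])))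
  inPrefix s (tri< x<i _ _) (tri> _ _ i<y) =
    precedes-++ (∈-filter⁺ (_<? i) (head-∈ s) x<i) (∈-++⁺ˡ (∈-filter⁺ (i <?_) (later-∈ s) i<y))
  inPrefix s (tri> _ _ i<x) (tri< y<i _ _) with precedes-++⁻ P (inPR (guard y<i i<x))
  ... | inj₁ i≺x = ⊥-elim (All.lookup P≢i (head-∈ i≺x) refl)
  ... | inj₂ (inj₁ (i∈P , _)) = ⊥-elim (All.lookup P≢i i∈P refl)
  ... | inj₂ (inj₂ i≺x) = ⊥-elim (unique-disjoint P (subst Unique (sym (prefix++suffix i π)) u) (head-∈ s) (later-∈ i≺x))
  byLocation : Precedes P x y ⊎ (x ∈ P × y ∈ R) ⊎ Precedes R x y → Precedes (swlᵢ i π) x y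
  byLocation (inj₂ (inj₂ s)) = ⊆-++ˡ (lower i P) (⊆-++ˡ (upper i P) s)
  byLocation (inj₂ (inj₁ (x∈P , y∈R))) =
    subst (λ ρ → Precedes ρ x y) (++-assoc (lower i P) _ _)
      (precedes-++ (∈-lower++upper x∈P (All.lookup P≢i x∈P)) y∈R)
  byLocation (inj₁ s) = inPrefix s (<-cmp x i) (<-cmp y i)

swlUpTo-invariant : ∀ (Inv : List ℕ → Set) → (∀ i {π} → Inv π → Inv (swlᵢ i π)) →
  ∀ k {π} → Inv π → Inv (swlUpTo k π)
swlUpTo-invariant Inv step zero I = I
swlUpTo-invariant Inv step (suc k) I = swlUpTo-invariant Inv step k (step (suc k) I)

swlUpTo-↭ : ∀ k π → swlUpTo k π ↭ π
swlUpTo-↭ k π = swlUpTo-invariant (_↭ π) (λ i {ρ} ρ↭π → ↭-trans (swlᵢ-↭ i ρ) ρ↭π) k ↭-refl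

unique-swlUpTo : ∀ k {π} → Unique π → Unique (swlUpTo k π)
unique-swlUpTo = swlUpTo-invariant Unique unique-swlᵢ

swlUpTo-keeps-ascent : ∀ k {π x y} → x < y → Unique π → Precedes π x y → Precedes (swlUpTo k π) x y
swlUpTo-keeps-ascent k {π} {x} {y} x<y u x≺y =
  proj₂ (swlUpTo-invariant Inv step k (u , x≺y))
  where
  Inv : List ℕ → Set
  Inv ρ = Unique ρ × Precedes ρ x y
  step : ∀ i {ρ} → Inv ρ → Inv (swlᵢ i ρ)
  step i (u , x≺y) = unique-swlᵢ i u , swlᵢ-preserves-order u x≺y (λ y<i i<x → ⊥-elim (<-asym x<y (<-trans y<i i<x)))

swlUpTo-keeps-descent : ∀ k {π x y} → x < y → Unique π → Precedes π y x →
  (∀ v → x < v → v < y → Precedes π v y) → Precedes (swlUpTo k π) y x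
swlUpTo-keeps-descent k {π} {x} {y} x<y u y≺x between =
  proj₁ (proj₂ (swlUpTo-invariant Inv step k (u , y≺x , between)))
  where
  Inv : List ℕ → Set
  Inv ρ = Unique ρ × Precedes ρ y x × (∀ v → x < v → v < y → Precedes ρ v y)
  step : ∀ i {ρ} → Inv ρ → Inv (swlᵢ i ρ)
  step i (u , y≺x , between) =
    unique-swlᵢ i u ,
    swlᵢ-preserves-order u y≺x (λ x<i i<y → between i x<i i<y) ,
    λ v x<v v<y → swlᵢ-preserves-order u (between v x<v v<y) (λ y<i i<v → ⊥-elim (<-asym v<y (<-trans y<i i<v)))

⟨⟩-tail : ∀ x π i → 1 ≤ i → (x ∷ π) ⟨ suc i ⟩ ≡ π ⟨ i ⟩
⟨⟩-tail x π (suc i) _ = refl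

⟨⟩-∈ : ∀ π k → 1 ≤ k → k ≤ length π → π ⟨ k ⟩ ∈ π
⟨⟩-∈ (x ∷ π) (suc zero) _ _ = here refl
⟨⟩-∈ (x ∷ π) (suc (suc k)) _ (s≤s k≤) = there (⟨⟩-∈ π (suc k) (s≤s z≤n) k≤)

⟨⟩-precedes : ∀ π j k → 1 ≤ j → j < k → k ≤ length π → Precedes π (π ⟨ j ⟩) (π ⟨ k ⟩)
⟨⟩-precedes (x ∷ π) (suc zero) (suc zero) _ (s≤s ()) _
⟨⟩-precedes (x ∷ π) (suc zero) (suc (suc k)) _ _ (s≤s k≤) = refl ∷ from∈ (⟨⟩-∈ π (suc k) (s≤s z≤n) k≤)
⟨⟩-precedes (x ∷ π) (suc (suc j)) (suc (suc k)) _ (s≤s j<k) (s≤s k≤) =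
  x ∷ʳ ⟨⟩-precedes π (suc j) (suc k) (s≤s z≤n) j<k k≤

posOf-correct : ∀ π v → v ∈ π → π ⟨ posOf π v ⟩ ≡ v × 1 ≤ posOf π v × posOf π v ≤ length π
posOf-correct (x ∷ π) v v∈ with x ≟ v
... | yes x≡v = x≡v , s≤s z≤n , s≤s z≤n
posOf-correct (x ∷ π) v (here v≡x) | no x≢v = ⊥-elim (x≢v (sym v≡x))
posOf-correct (x ∷ π) v (there v∈π) | no _ with posOf-correct π v v∈π
... | at , 1≤p , p≤ with posOf π v | 1≤p
...   | suc p | _ = at , s≤s z≤n , s≤s p≤

⟨⟩-injective : ∀ π j k → Unique π → 1 ≤ j → j ≤ length π → 1 ≤ k → k ≤ length π →
  π ⟨ j ⟩ ≡ π ⟨ k ⟩ → j ≡ k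
⟨⟩-injective π j k u 1≤j j≤ 1≤k k≤ eq with <-cmp j k
... | tri≈ _ j≡k _ = j≡k
... | tri< j<k _ _ = ⊥-elim (precedes-asym u s s)
  where s = subst (Precedes π (π ⟨ j ⟩)) (sym eq) (⟨⟩-precedes π j k 1≤j j<k k≤)
... | tri> _ _ k<j = ⊥-elim (precedes-asym u s s)
  where s = subst (Precedes π (π ⟨ k ⟩)) eq (⟨⟩-precedes π k j 1≤k k<j j≤)

posOf-⟨⟩ : ∀ π j → Unique π → 1 ≤ j → j ≤ length π → posOf π (π ⟨ j ⟩) ≡ j
posOf-⟨⟩ π j u 1≤j j≤ with posOf-correct π (π ⟨ j ⟩) (⟨⟩-∈ π j 1≤j j≤)
... | at , 1≤p , p≤ = ⟨⟩-injective π _ j u 1≤p p≤ 1≤j j≤ at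

precedes-positions : ∀ {π x y} → Precedes π x y →
  ∃ λ p → ∃ λ q → 1 ≤ p × p < q × q ≤ length π × π ⟨ p ⟩ ≡ x × π ⟨ q ⟩ ≡ y
precedes-positions {h ∷ π} (_ ∷ʳ s) with precedes-positions s
... | p , q , 1≤p , p<q , q≤ , at-p , at-q =
  suc p , suc q , s≤s z≤n , s≤s p<q , s≤s q≤ ,
  trans (⟨⟩-tail h π p 1≤p) at-p , trans (⟨⟩-tail h π q (≤-trans 1≤p (<⇒≤ p<q))) at-q
precedes-positions {h ∷ π} {y = y} (refl ∷ s) with posOf-correct π y (to∈ s)
... | at , 1≤q , q≤ =
  1 , suc (posOf π y) , s≤s z≤n , s≤s 1≤q , s≤s q≤ , refl , trans (⟨⟩-tail h π _ 1≤q) at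

triple-positions : ∀ {π x y z} → x ∷ y ∷ z ∷ [] ⊆ π → ∃ λ p → ∃ λ q → ∃ λ r →
  1 ≤ p × p < q × q < r × r ≤ length π × π ⟨ p ⟩ ≡ x × π ⟨ q ⟩ ≡ y × π ⟨ r ⟩ ≡ z
triple-positions {h ∷ π} (_ ∷ʳ s) with triple-positions s
... | p , q , r , 1≤p , p<q , q<r , r≤ , at-p , at-q , at-r =
  suc p , suc q , suc r , s≤s z≤n , s≤s p<q , s≤s q<r , s≤s r≤ ,
  trans (⟨⟩-tail h π p 1≤p) at-p , trans (⟨⟩-tail h π q (≤-trans 1≤p (<⇒≤ p<q))) at-q ,
  trans (⟨⟩-tail h π r (≤-trans 1≤p (<⇒≤ (<-trans p<q q<r)))) at-r
triple-positions {h ∷ π} (refl ∷ s) with precedes-positions s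
... | q , r , 1≤q , q<r , r≤ , at-q , at-r =
  1 , suc q , suc r , s≤s z≤n , s≤s 1≤q , s≤s q<r , s≤s r≤ , refl ,
  trans (⟨⟩-tail h π q 1≤q) at-q , trans (⟨⟩-tail h π r (≤-trans 1≤q (<⇒≤ q<r))) at-r

Avoids132ˢ : List ℕ → Set
Avoids132ˢ π = ∀ a b c → a ∷ b ∷ c ∷ [] ⊆ π → ¬ (a < c × c < b)

avoids132ˢ : ∀ {π} → Avoids132 π → Avoids132ˢ π
avoids132ˢ av a b c s with triple-positions s
... | p , q , r , 1≤p , p<q , q<r , r≤ , refl , refl , refl = av p q r 1≤p p<q q<r r≤

avoids132ˢ-⊆ : ∀ {ρ π} → ρ ⊆ π → Avoids132ˢ π → Avoids132ˢ ρ
avoids132ˢ-⊆ ρ⊆π av a b c s = av a b c (⊆-trans s ρ⊆π)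

oneTo : ℕ → List ℕ
oneTo n = map suc (upTo n)

oneTo-suc : ∀ m → oneTo (suc m) ≡ oneTo m ++ [ suc m ]
oneTo-suc m = trans (cong (map suc) (sym (upTo-∷ʳ m))) (map-++ suc (upTo m) [ m ])

oneTo-∈⁻ : ∀ {n x} → x ∈ oneTo n → 1 ≤ x × x ≤ n
oneTo-∈⁻ x∈ with ∈-map⁻ suc x∈
... | _ , y∈ , refl = s≤s z≤n , ∈-upTo⁻ y∈

oneTo-∈⁺ : ∀ {n x} → 1 ≤ x → x ≤ n → x ∈ oneTo n
oneTo-∈⁺ {x = suc x} _ x≤n = ∈-map⁺ suc (∈-upTo⁺ x≤n)

oneTo-increasing : ∀ n → AllPairs _<_ (oneTo n)
oneTo-increasing n = subst (AllPairs _<_) (sym (map-upTo suc n)) (applyUpTo⁺₁ suc n (λ i<j _ → s≤s i<j))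

perm-unique : ∀ {n τ} → IsPerm n τ → Unique τ
perm-unique {n} p = unique-↭ (↭-sym p) (Unique-map⁺ suc-injective (upTo⁺ n))

perm-∈ : ∀ {n τ v} → IsPerm n τ → 1 ≤ v → v ≤ n → v ∈ τ
perm-∈ p 1≤v v≤n = ∈-resp-↭ (↭-sym p) (oneTo-∈⁺ 1≤v v≤n)

perm-bounds : ∀ {n τ v} → IsPerm n τ → v ∈ τ → 1 ≤ v × v ≤ n
perm-bounds p v∈ = oneTo-∈⁻ (∈-resp-↭ p v∈)

perm-length : ∀ {n τ} → IsPerm n τ → length τ ≡ n
perm-length {n} p = trans (↭-length p) (trans (length-map suc (upTo n)) (length-upTo n))

perm-delete-max : ∀ {m} α β → IsPerm (suc m) (α ++ suc m ∷ β) → IsPerm m (α ++ β)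
perm-delete-max {m} α β p = subst (α ++ β ↭_) (++-identityʳ (oneTo m))
  (drop-mid α (oneTo m) (subst (α ++ suc m ∷ β ↭_) (oneTo-suc m) p))

del : ℕ → List ℕ → List ℕ
del n = filter (λ x → ¬? (x ≟ n))

del-drop : ∀ n π → del n (n ∷ π) ≡ del n π
del-drop n π = filter-reject (λ x → ¬? (x ≟ n)) (λ n≢n → n≢n refl)

del-keep : ∀ {n x} π → x ≢ n → del n (x ∷ π) ≡ x ∷ del n π
del-keep {n} π x≢n = filter-accept (λ x → ¬? (x ≟ n)) x≢n

del-splitAt : ∀ n i π → i ≢ n → splitAt i (del n π) ≡ Product.map (del n) (del n) (splitAt i π)
del-splitAt n i [] _ = refl
del-splitAt n i (x ∷ π) i≢n with x ≟ n | x ≟ i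
... | yes refl | yes refl = ⊥-elim (i≢n refl)
... | yes refl | no x≢i = begin
  splitAt i (del x (x ∷ π))                  ≡⟨ cong (splitAt i) (del-drop x π) ⟩
  splitAt i (del x π)                        ≡⟨ del-splitAt x i π i≢n ⟩
  (del x (prefix i π) , del x (suffix i π))  ≡⟨ cong (_, del x (suffix i π)) (del-drop x (prefix i π)) ⟨
  (del x (x ∷ prefix i π) , del x (suffix i π)) ∎
  where open ≡-Reasoning
... | no x≢n | yes refl = begin
  splitAt x (del n (x ∷ π))    ≡⟨ cong (splitAt x) (del-keep π x≢n) ⟩
  splitAt x (x ∷ del n π)      ≡⟨ splitAt-head x (del n π) ⟩
  ([] , x ∷ del n π)           ≡⟨ cong ([] ,_) (del-keep π x≢n) ⟨
  ([] , del n (x ∷ π))         ∎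
  where open ≡-Reasoning
... | no x≢n | no x≢i = begin
  splitAt i (del n (x ∷ π))    ≡⟨ cong (splitAt i) (del-keep π x≢n) ⟩
  splitAt i (x ∷ del n π)      ≡⟨ splitAt-other (del n π) x≢i ⟩
  (x ∷ prefix i (del n π) , suffix i (del n π))     ≡⟨ cong (λ p → x ∷ proj₁ p , proj₂ p) (del-splitAt n i π i≢n) ⟩
  (x ∷ del n (prefix i π) , del n (suffix i π))     ≡⟨ cong (_, del n (suffix i π)) (del-keep (prefix i π) x≢n) ⟨
  (del n (x ∷ prefix i π) , del n (suffix i π))     ∎
  where open ≡-Reasoning

filter-comm : ∀ {P Q : ℕ → Set} (P? : Decidable P) (Q? : Decidable Q) xs →
  filter P? (filter Q? xs) ≡ filter Q? (filter P? xs)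
filter-comm P? Q? [] = refl
filter-comm {P} {Q} P? Q? (x ∷ xs) = byCases (P? x) (Q? x)
  where
  byCases : Dec (P x) → Dec (Q x) → filter P? (filter Q? (x ∷ xs)) ≡ filter Q? (filter P? (x ∷ xs))
  byCases (yes p) (yes q) rewrite filter-accept Q? {x} {xs} q | filter-accept P? {x} {filter Q? xs} p
    | filter-accept P? {x} {xs} p | filter-accept Q? {x} {filter P? xs} q = cong (x ∷_) (filter-comm P? Q? xs)
  byCases (yes p) (no ¬q) rewrite filter-reject Q? {x} {xs} ¬q | filter-accept P? {x} {xs} p
    | filter-reject Q? {x} {filter P? xs} ¬q = filter-comm P? Q? xs
  byCases (no ¬p) (yes q) rewrite filter-accept Q? {x} {xs} q | filter-reject P? {x} {filter Q? xs} ¬p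
    | filter-reject P? {x} {xs} ¬p = filter-comm P? Q? xs
  byCases (no ¬p) (no ¬q) rewrite filter-reject Q? {x} {xs} ¬q | filter-reject P? {x} {xs} ¬p = filter-comm P? Q? xs

del-swlᵢ : ∀ n i π → i ≢ n → del n (swlᵢ i π) ≡ swlᵢ i (del n π)
del-swlᵢ n i π i≢n = begin
  del n (lower i P ++ upper i P ++ R)              ≡⟨ filter-++ (λ x → ¬? (x ≟ n)) (lower i P) _ ⟩
  del n (lower i P) ++ del n (upper i P ++ R)      ≡⟨ cong (del n (lower i P) ++_) (filter-++ (λ x → ¬? (x ≟ n)) (upper i P) R) ⟩
  del n (lower i P) ++ del n (upper i P) ++ del n R
    ≡⟨ cong₂ (λ B T → B ++ T ++ del n R) (filter-comm (λ x → ¬? (x ≟ n)) (_<? i) P) (filter-comm (λ x → ¬? (x ≟ n)) (i <?_) P) ⟩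
  lower i (del n P) ++ upper i (del n P) ++ del n R ≡⟨ cong (λ p → lower i (proj₁ p) ++ upper i (proj₁ p) ++ proj₂ p) (del-splitAt n i π i≢n) ⟨
  swlᵢ i (del n π)                                 ∎
  where
  open ≡-Reasoning
  P = prefix i π
  R = suffix i π

del-swlUpTo : ∀ n k π → k < n → del n (swlUpTo k π) ≡ swlUpTo k (del n π)
del-swlUpTo n zero π _ = refl
del-swlUpTo n (suc k) π k<n =
  trans (del-swlUpTo n k (swlᵢ (suc k) π) (<-trans (n<1+n k) k<n))
        (cong (swlUpTo k) (del-swlᵢ n (suc k) π (λ k≡n → <-irrefl k≡n k<n)))

swlᵢ-max : ∀ n π → All (_≤ n) π → swlᵢ n π ≡ π
swlᵢ-max n π π≤n = begin
  lower n P ++ upper n P ++ R  ≡⟨ cong₂ (λ B T → B ++ T ++ R) (filter-all (_<? n) below) (filter-none (n <?_) notAbove) ⟩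
  P ++ R                       ≡⟨ prefix++suffix n π ⟩
  π                            ∎
  where
  open ≡-Reasoning
  P = prefix n π
  R = suffix n π
  bound : ∀ {x} → x ∈ P → x ≤ n
  bound x∈ = All.lookup π≤n (subst (_ ∈_) (prefix++suffix n π) (∈-++⁺ˡ x∈))
  below : All (_< n) P
  below = All.tabulate (λ x∈ → ≤∧≢⇒< (bound x∈) (All.lookup (prefix-avoids n π) x∈))
  notAbove : All (λ x → ¬ (n < x)) P
  notAbove = All.tabulate (λ x∈ → ≤⇒≯ (bound x∈))

del-middle : ∀ n α β → Unique (α ++ n ∷ β) → del n (α ++ n ∷ β) ≡ α ++ β
del-middle n α β u = begin
  del n (α ++ n ∷ β)        ≡⟨ filter-++ (λ x → ¬? (x ≟ n)) α (n ∷ β) ⟩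
  del n α ++ del n (n ∷ β)  ≡⟨ cong (del n α ++_) (del-drop n β) ⟩
  del n α ++ del n β        ≡⟨ cong₂ _++_ (filter-all (λ x → ¬? (x ≟ n)) n∉α) (filter-all (λ x → ¬? (x ≟ n)) n∉β) ⟩
  α ++ β                    ∎
  where
  open ≡-Reasoning
  n∉α : All (_≢ n) α
  n∉α = All.tabulate (λ x∈α x≡n → unique-disjoint α u x∈α (subst (_∈ n ∷ β) (sym x≡n) (here refl)))
  n∉β : All (_≢ n) β
  n∉β = All.tabulate (λ x∈β x≡n → Unique[x∷xs]⇒x∉xs (unique-⊆ (⊆-++ˡ α ⊆-refl) u) (subst (_∈ β) x≡n x∈β))

del-swl : ∀ m α β → IsPerm (suc m) (α ++ suc m ∷ β) →
  del (suc m) (swlUpTo (suc m) (α ++ suc m ∷ β)) ≡ swlUpTo m (α ++ β)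
del-swl m α β p = begin
  del n (swlUpTo m (swlᵢ n τ))   ≡⟨ cong (λ ρ → del n (swlUpTo m ρ)) (swlᵢ-max n τ (All.tabulate (λ x∈ → proj₂ (perm-bounds p x∈)))) ⟩
  del n (swlUpTo m τ)            ≡⟨ del-swlUpTo n m τ ≤-refl ⟩
  swlUpTo m (del n τ)            ≡⟨ cong (swlUpTo m) (del-middle n α β (perm-unique p)) ⟩
  swlUpTo m (α ++ β)             ∎
  where
  open ≡-Reasoning
  n = suc m
  τ = α ++ n ∷ β

++-≡-cases : ∀ (α β α' β' : List ℕ) → α ++ β ≡ α' ++ β' →
  (α ≡ α' × β ≡ β')
  ⊎ (∃ λ g → ∃ λ γ → α' ≡ α ++ g ∷ γ × β ≡ (g ∷ γ) ++ β')
  ⊎ (∃ λ g → ∃ λ γ → α ≡ α' ++ g ∷ γ × β' ≡ (g ∷ γ) ++ β)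
++-≡-cases [] β [] β' eq = inj₁ (refl , eq)
++-≡-cases [] β (a' ∷ α') β' eq = inj₂ (inj₁ (a' , α' , refl , eq))
++-≡-cases (a ∷ α) β [] β' eq = inj₂ (inj₂ (a , α , refl , sym eq))
++-≡-cases (a ∷ α) β (a' ∷ α') β' eq with ∷-injective eq
... | refl , eq' with ++-≡-cases α β α' β' eq'
...   | inj₁ (refl , β≡β') = inj₁ (refl , β≡β')
...   | inj₂ (inj₁ (g , γ , refl , β≡)) = inj₂ (inj₁ (g , γ , refl , β≡))
...   | inj₂ (inj₂ (g , γ , refl , β'≡)) = inj₂ (inj₂ (g , γ , refl , β'≡))

max-∈ : ∀ g γ → max g γ ∈ g ∷ γ
max-∈ g γ with argmax-sel (λ x → x) g γ
... | inj₁ max≡g = subst (_∈ g ∷ γ) (sym max≡g) (here refl)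
... | inj₂ max∈γ = there max∈γ

≤-max : ∀ {g γ x} → x ∈ g ∷ γ → x ≤ max g γ
≤-max {g} {γ} (here refl) = ⊥≤max g γ
≤-max {g} {γ} (there x∈γ) = All.lookup (xs≤max g γ) x∈γ

-- Moving the maximum n to the right past a non-empty block G changes swl:
-- for k = max G, n stays before k in swl (α n G β) because every value
-- strictly between k and n lies in α (by 132-avoidance of α G n β), while
-- k stays before n in swl (α G n β).
moving-max-changes-swl : ∀ m α g γ β →
  IsPerm (suc m) (α ++ suc m ∷ (g ∷ γ) ++ β) → IsPerm (suc m) (α ++ (g ∷ γ) ++ suc m ∷ β) →
  Avoids132ˢ (α ++ (g ∷ γ) ++ suc m ∷ β) →
  swlUpTo (suc m) (α ++ suc m ∷ (g ∷ γ) ++ β) ≢ swlUpTo (suc m) (α ++ (g ∷ γ) ++ suc m ∷ β)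
moving-max-changes-swl m α g γ β p p' av' eq =
  precedes-asym (unique-swlUpTo n (perm-unique p')) (subst (λ ρ → Precedes ρ n k) eq n≺k) k≺n
  where
  n = suc m
  G = g ∷ γ
  τ = α ++ n ∷ G ++ β
  k = max g γ
  k∈G : k ∈ G
  k∈G = max-∈ g γ
  k<n : k < n
  k<n = ≤∧≢⇒< (proj₂ (perm-bounds p (∈-++⁺ʳ α (there (∈-++⁺ˡ k∈G))))) λ k≡n →
    Unique[x∷xs]⇒x∉xs (unique-⊆ (⊆-++ˡ α ⊆-refl) (perm-unique p)) (subst (_∈ G ++ β) k≡n (∈-++⁺ˡ k∈G))
  between : ∀ v → k < v → v < n → Precedes τ v n
  between v k<v v<n with ∈-++⁻ α (perm-∈ p (≤-trans (s≤s z≤n) k<v) (<⇒≤ v<n))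
  ... | inj₁ v∈α = precedes-++ v∈α (here refl)
  ... | inj₂ (here v≡n) = ⊥-elim (<-irrefl v≡n v<n)
  ... | inj₂ (there v∈Gβ) with ∈-++⁻ G v∈Gβ
  ...   | inj₁ v∈G = ⊥-elim (<⇒≱ k<v (≤-max v∈G))
  ...   | inj₂ v∈β = ⊥-elim (av' k n v (⊆-++ˡ α (⊆-++⁺ (from∈ k∈G) (refl ∷ from∈ v∈β))) (k<v , v<n))
  n≺k : Precedes (swlUpTo n τ) n k
  n≺k = swlUpTo-keeps-descent n k<n (perm-unique p) (⊆-++ˡ α (refl ∷ from∈ (∈-++⁺ˡ k∈G))) between
  k≺n : Precedes (swlUpTo n (α ++ G ++ n ∷ β)) k n
  k≺n = swlUpTo-keeps-ascent n k<n (perm-unique p') (⊆-++ˡ α (⊆-++⁺ (from∈ k∈G) (refl ∷ minimum β)))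

swl-injective : ∀ m τ τ' → IsPerm m τ → IsPerm m τ' → Avoids132ˢ τ → Avoids132ˢ τ' →
  swlUpTo m τ ≡ swlUpTo m τ' → τ ≡ τ'
swl-injective zero τ τ' p p' _ _ _ = trans (↭-empty-inv p) (sym (↭-empty-inv p'))
swl-injective (suc m) τ τ' p p' av av' eq
  with ∈-∃++ (perm-∈ p (s≤s z≤n) (≤-refl {suc m})) | ∈-∃++ (perm-∈ p' (s≤s z≤n) (≤-refl {suc m}))
... | α , β , refl | α' , β' , refl = byCut (++-≡-cases α β α' β' rest-equal)
  where
  n = suc m
  rest-equal : α ++ β ≡ α' ++ β'
  rest-equal = swl-injective m (α ++ β) (α' ++ β') (perm-delete-max α β p) (perm-delete-max α' β' p')
    (avoids132ˢ-⊆ (⊆-++⁺ ⊆-refl (n ∷ʳ ⊆-refl)) av) (avoids132ˢ-⊆ (⊆-++⁺ ⊆-refl (n ∷ʳ ⊆-refl)) av')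
    (trans (sym (del-swl m α β p)) (trans (cong (del n) eq) (del-swl m α' β' p')))
  byCut : (α ≡ α' × β ≡ β')
        ⊎ (∃ λ g → ∃ λ γ → α' ≡ α ++ g ∷ γ × β ≡ (g ∷ γ) ++ β')
        ⊎ (∃ λ g → ∃ λ γ → α ≡ α' ++ g ∷ γ × β' ≡ (g ∷ γ) ++ β) →
        α ++ n ∷ β ≡ α' ++ n ∷ β'
  byCut (inj₁ (refl , refl)) = refl
  byCut (inj₂ (inj₁ (g , γ , refl , refl))) =
    ⊥-elim (moving-max-changes-swl m α g γ β' p (subst (IsPerm n) assoc p') (subst Avoids132ˢ assoc av')
      (trans eq (cong (swlUpTo n) assoc)))
    where assoc = ++-assoc α (g ∷ γ) (n ∷ β')
  byCut (inj₂ (inj₂ (g , γ , refl , refl))) =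
    ⊥-elim (moving-max-changes-swl m α' g γ β p' (subst (IsPerm n) assoc p) (subst Avoids132ˢ assoc av)
      (trans (sym eq) (cong (swlUpTo n) assoc)))
    where assoc = ++-assoc α' (g ∷ γ) (n ∷ β)

-- Left-to-right maxima of swl τ come from ascents w, w+1 of τ.

PrecedesLarger : ℕ → List ℕ → Set
PrecedesLarger w π = ∀ z → w < z → z ∈ π → Precedes π w z

-- swl_{w+1} moves w (from the prefix before w+1) in front of all larger
-- entries, which go to T or stay in the suffix.
swl-suc-places : ∀ w π → Unique π → Precedes π w (suc w) → PrecedesLarger w (swlᵢ (suc w) π)
swl-suc-places w π u w≺i z w<z z∈ = byPart (∈-++⁻ (lower i P) z∈)
  where
  i = suc w
  P = prefix i π
  R = suffix i π
  notInSuffix : Precedes R w i → ⊥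
  notInSuffix w≺i with suffix-shape i π
  ... | inj₁ R≡[] with () ← subst (λ ρ → Precedes ρ w i) R≡[] w≺i
  ... | inj₂ (R' , R≡iR') with subst (λ ρ → Precedes ρ w i) R≡iR' w≺i
  ...   | _ ∷ʳ w≺i' = Unique[x∷xs]⇒x∉xs (unique-⊆ (⊆-++ˡ P ⊆-refl) (subst Unique (trans (sym (prefix++suffix i π)) (cong (P ++_) R≡iR')) u)) (later-∈ w≺i')
  w∈P : w ∈ P
  w∈P with precedes-++⁻ P (subst (λ ρ → Precedes ρ w i) (sym (prefix++suffix i π)) w≺i)
  ... | inj₁ both = ⊥-elim (All.lookup (prefix-avoids i π) (later-∈ both) refl)
  ... | inj₂ (inj₁ (w∈P , _)) = w∈P
  ... | inj₂ (inj₂ both) = ⊥-elim (notInSuffix both)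
  byPart : z ∈ lower i P ⊎ z ∈ upper i P ++ R → Precedes (swlᵢ i π) w z
  byPart (inj₁ z∈lower) = ⊥-elim (<⇒≱ (proj₂ (∈-filter⁻ (_<? i) {xs = P} z∈lower)) w<z)
  byPart (inj₂ z∈rest) = precedes-++ (∈-filter⁺ (_<? i) w∈P ≤-refl) z∈rest

ascent⇒precedesLarger : ∀ w k π → w < k → Unique π → Precedes π w (suc w) → PrecedesLarger w (swlUpTo k π)
ascent⇒precedesLarger w (suc k) π w<sk u w≺ with k ≟ w
... | yes refl = λ z w<z z∈ → swlUpTo-keeps-ascent k w<z (unique-swlᵢ (suc w) u)
                   (swl-suc-places w π u w≺ z w<z (∈-resp-↭ (swlUpTo-↭ k _) z∈))
... | no k≢w = ascent⇒precedesLarger w k (swlᵢ (suc k) π) (≤∧≢⇒< (≤-pred w<sk) (λ w≡k → k≢w (sym w≡k)))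
                 (unique-swlᵢ (suc k) u)
                 (swlᵢ-preserves-order u w≺ (λ sw<i i<w → ⊥-elim (<-asym (<-trans (n<1+n w) sw<i) i<w)))

precedesLarger⇒leftSmaller : ∀ w σ → w ∈ σ → Unique σ → PrecedesLarger w σ →
  ∀ j → 1 ≤ j → j < posOf σ w → σ ⟨ j ⟩ < w
precedesLarger⇒leftSmaller w σ w∈ u larger j 1≤j j<p with posOf-correct σ w w∈
... | at , _ , p≤ with <-cmp (σ ⟨ j ⟩) w
...   | tri< σj<w _ _ = σj<w
...   | tri≈ _ σj≡w _ = ⊥-elim (precedes-asym u s s)
  where s = subst₂ (Precedes σ) σj≡w at (⟨⟩-precedes σ j (posOf σ w) 1≤j j<p p≤)
...   | tri> _ _ w<σj = ⊥-elim (precedes-asym u (subst (Precedes σ (σ ⟨ j ⟩)) at (⟨⟩-precedes σ j (posOf σ w) 1≤j j<p p≤))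
                            (larger _ w<σj (⟨⟩-∈ σ j 1≤j (≤-trans (<⇒≤ j<p) p≤))))

-- The position of nw applied to the point of height v of σ, and its height;
-- nw σ (swlPt σ A) is (nwPos σ h , nwHeight σ h) for A of height h.
nwPos : List ℕ → ℕ → ℕ
nwPos σ v = firstNW σ (σ ⟨ posOf σ v ⟩) (posOf σ v) (oneTo (posOf σ v))

nwHeight : List ℕ → ℕ → ℕ
nwHeight σ v = σ ⟨ nwPos σ v ⟩

firstNW-cases : ∀ σ v d js → firstNW σ v d js ≡ d ⊎ (firstNW σ v d js ∈ js × v ≤ σ ⟨ firstNW σ v d js ⟩)
firstNW-cases σ v d [] = inj₁ refl
firstNW-cases σ v d (j ∷ js) with isLRmax σ j ∧ (v ≤ᵇ σ ⟨ j ⟩) in test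
... | true = inj₂ (here refl , ≤ᵇ⇒≤ _ _ (proj₂ (Equivalence.to (T-∧ {isLRmax σ j}) (subst T (sym test) _))))
... | false with firstNW-cases σ v d js
...   | inj₁ fallback = inj₁ fallback
...   | inj₂ (j∈ , v≤) = inj₂ (there j∈ , v≤)

firstNW-leftmost : ∀ σ v d js k → AllPairs _<_ js → k ∈ js → T (isLRmax σ k ∧ (v ≤ᵇ σ ⟨ k ⟩)) →
  firstNW σ v d js ≤ k
firstNW-leftmost σ v d (j ∷ js) k (j< ∷ inc) k∈ ok with isLRmax σ j ∧ (v ≤ᵇ σ ⟨ j ⟩) in test
firstNW-leftmost σ v d (j ∷ js) k (j< ∷ inc) (here refl) ok | true = ≤-refl
firstNW-leftmost σ v d (j ∷ js) k (j< ∷ inc) (there k∈) ok | true = <⇒≤ (All.lookup j< k∈)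
firstNW-leftmost σ v d (j ∷ js) k (j< ∷ inc) (here refl) ok | false = ⊥-elim (subst T test ok)
firstNW-leftmost σ v d (j ∷ js) k (j< ∷ inc) (there k∈) ok | false = firstNW-leftmost σ v d js k inc k∈ ok

isLRmax-intro : ∀ σ p → (∀ j → 1 ≤ j → j < p → σ ⟨ j ⟩ ≤ σ ⟨ p ⟩) → T (isLRmax σ p)
isLRmax-intro σ p left≤ = all⁻ (λ k → σ ⟨ k ⟩ ≤ᵇ σ ⟨ p ⟩)
  (All.tabulate λ j∈ → ≤⇒≤ᵇ (left≤ _ (proj₁ (oneTo-∈⁻ j∈)) (before p (proj₁ (oneTo-∈⁻ j∈)) (proj₂ (oneTo-∈⁻ j∈)))))
  where
  before : ∀ p {j} → 1 ≤ j → j ≤ p ∸ 1 → j < p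
  before (suc p) _ j≤ = s≤s j≤
  before zero {suc j} _ ()

nwPos-bounds : ∀ σ v → 1 ≤ posOf σ v → 1 ≤ nwPos σ v × nwPos σ v ≤ posOf σ v
nwPos-bounds σ v 1≤p with firstNW-cases σ (σ ⟨ posOf σ v ⟩) (posOf σ v) (oneTo (posOf σ v))
... | inj₁ fallback = subst (1 ≤_) (sym fallback) 1≤p , ≤-reflexive fallback
... | inj₂ (j∈ , _) = oneTo-∈⁻ j∈

nwHeight-≥ : ∀ σ v → v ∈ σ → v ≤ nwHeight σ v
nwHeight-≥ σ v v∈ with posOf-correct σ v v∈ | firstNW-cases σ (σ ⟨ posOf σ v ⟩) (posOf σ v) (oneTo (posOf σ v))
... | at , _ | inj₁ fallback = ≤-reflexive (trans (sym at) (cong (σ ⟨_⟩) (sym fallback)))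
... | at , _ | inj₂ (_ , v≤) = subst (_≤ nwHeight σ v) at v≤

nwHeight-≤ : ∀ σ v w → v ∈ σ → w ∈ σ → v ≤ w → (∀ j → 1 ≤ j → j < posOf σ w → σ ⟨ j ⟩ < w) → nwHeight σ v ≤ w
nwHeight-≤ σ v w v∈ w∈ v≤w leftSmaller with posOf-correct σ v v∈ | posOf-correct σ w w∈
... | at-v , 1≤pv , _ | at-w , 1≤pw , _ with nwPos-bounds σ v 1≤pv | ≤-<-connex (posOf σ w) (posOf σ v)
...   | 1≤r , r≤pv | inj₂ pv<pw = <⇒≤ (leftSmaller (nwPos σ v) 1≤r (≤-<-trans r≤pv pv<pw))
...   | 1≤r , r≤pv | inj₁ pw≤pv = atMost (m≤n⇒m<n∨m≡n r≤pw)
  where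
  candidate : T (isLRmax σ (posOf σ w) ∧ ((σ ⟨ posOf σ v ⟩) ≤ᵇ σ ⟨ posOf σ w ⟩))
  candidate = Equivalence.from T-∧
    ( isLRmax-intro σ (posOf σ w) (λ j 1≤j j<pw → subst (σ ⟨ j ⟩ ≤_) (sym at-w) (<⇒≤ (leftSmaller j 1≤j j<pw)))
    , ≤⇒≤ᵇ (subst₂ _≤_ (sym at-v) (sym at-w) v≤w))
  r≤pw : nwPos σ v ≤ posOf σ w
  r≤pw = firstNW-leftmost σ _ _ (oneTo (posOf σ v)) (posOf σ w) (oneTo-increasing _) (oneTo-∈⁺ 1≤pw pw≤pv) candidate
  atMost : nwPos σ v < posOf σ w ⊎ nwPos σ v ≡ posOf σ w → nwHeight σ v ≤ w
  atMost (inj₁ r<pw) = <⇒≤ (leftSmaller (nwPos σ v) 1≤r r<pw)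
  atMost (inj₂ r≡pw) = ≤-reflexive (trans (cong (σ ⟨_⟩) r≡pw) at-w)

-- Doubled coordinates: an odd height is never the height of an endpoint,
-- and it lies strictly between 2a and 2b when a < b.
odd≢even : ∀ a b → suc (2 * a) ≢ 2 * b
odd≢even a b eq = even≢odd b a (sym eq)

2*-<-odd : ∀ {a b} → a < b → suc (2 * a) ≤ 2 * b
2*-<-odd {a} {b} a<b = ≤-trans (n≤1+n _) (subst (_≤ 2 * b) (*-suc 2 a) (*-monoʳ-≤ 2 a<b))

hookImage : List ℕ → List Hook → List Point
hookImage τ H = map (λ A → nw (swl τ) (swlPt (swl τ) A)) (NE τ H)

module HookRecovery (n : ℕ) (τ : List ℕ) (pτ : IsPerm n τ) (av : Avoids132 τ) where

  σ : List ℕ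
  σ = swl τ

  uτ : Unique τ
  uτ = perm-unique pτ

  length-τ : length τ ≡ n
  length-τ = perm-length pτ

  toσ : ∀ {x} → x ∈ τ → x ∈ σ
  toσ = ∈-resp-↭ (↭-sym (swlUpTo-↭ (length τ) τ))

  value-∈ : ∀ {x} → 1 ≤ x → x ≤ n → x ∈ τ
  value-∈ = perm-∈ pτ

  value-bounds : ∀ {k} → 1 ≤ k → k ≤ length τ → 1 ≤ τ ⟨ k ⟩ × τ ⟨ k ⟩ ≤ n
  value-bounds {k} 1≤k k≤ = perm-bounds pτ (⟨⟩-∈ τ k 1≤k k≤)

  posOf-τ : ∀ {k} → 1 ≤ k → k ≤ length τ → posOf τ (τ ⟨ k ⟩) ≡ k
  posOf-τ {k} = posOf-⟨⟩ τ k uτ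

  τ-injective : ∀ {k k'} → 1 ≤ k → k ≤ length τ → 1 ≤ k' → k' ≤ length τ → τ ⟨ k ⟩ ≡ τ ⟨ k' ⟩ → k ≡ k'
  τ-injective {k} {k'} = ⟨⟩-injective τ k k' uτ

  -- An ascent w, w+1 of τ with v ≤ w < c separates the nw-heights of v and
  -- c: w becomes a left-to-right maximum of σ, so nw(v) stays at height ≤ w.
  ascent⇒lower-height : ∀ {v w c} → 1 ≤ v → v ≤ w → w < c → c ≤ n →
    posOf τ w < posOf τ (suc w) → nwHeight σ v < nwHeight σ c
  ascent⇒lower-height {v} {w} {c} 1≤v v≤w w<c c≤n pw<pw+1 =
    ≤-<-trans (nwHeight-≤ σ v w (toσ v∈) (toσ w∈) v≤w leftSmaller) (<-≤-trans w<c (nwHeight-≥ σ c (toσ c∈)))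
    where
    w∈ : w ∈ τ
    w∈ = value-∈ (≤-trans 1≤v v≤w) (≤-trans (<⇒≤ w<c) c≤n)
    w+1∈ : suc w ∈ τ
    w+1∈ = value-∈ (s≤s z≤n) (≤-trans w<c c≤n)
    v∈ : v ∈ τ
    v∈ = value-∈ 1≤v (≤-trans v≤w (≤-trans (<⇒≤ w<c) c≤n))
    c∈ : c ∈ τ
    c∈ = value-∈ (≤-trans (≤-trans 1≤v v≤w) (<⇒≤ w<c)) c≤n
    w≺w+1 : Precedes τ w (suc w)
    w≺w+1 with posOf-correct τ w w∈ | posOf-correct τ (suc w) w+1∈
    ... | at , 1≤p , _ | at' , _ , p'≤ = subst₂ (Precedes τ) at at' (⟨⟩-precedes τ _ _ 1≤p pw<pw+1 p'≤)
    leftSmaller : ∀ j → 1 ≤ j → j < posOf σ w → σ ⟨ j ⟩ < w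
    leftSmaller = precedesLarger⇒leftSmaller w σ (toσ w∈) (unique-swlUpTo (length τ) uτ)
      (ascent⇒precedesLarger w (length τ) τ (subst (w <_) (sym length-τ) (≤-trans w<c c≤n)) uτ w≺w+1)

  record Tied (v c : ℕ) : Set where
    field
      1≤v  : 1 ≤ v
      c≤n  : c ≤ n
      same : nwHeight σ v ≡ nwHeight σ c

  tied⇒step-down : ∀ {v c} → Tied v c → ∀ w → v ≤ w → w < c → posOf τ (suc w) < posOf τ w
  tied⇒step-down {v} {c} t w v≤w w<c with <-cmp (posOf τ w) (posOf τ (suc w))
  ... | tri< pw<pw+1 _ _ = ⊥-elim (<-irrefl (Tied.same t) (ascent⇒lower-height (Tied.1≤v t) v≤w w<c (Tied.c≤n t) pw<pw+1))
  ... | tri> _ _ pw+1<pw = pw+1<pw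
  ... | tri≈ _ pw≡pw+1 _ = ⊥-elim (<-irrefl (trans (sym at) (trans (cong (τ ⟨_⟩) pw≡pw+1) at')) (n<1+n w))
    where
    at : τ ⟨ posOf τ w ⟩ ≡ w
    at = proj₁ (posOf-correct τ w (value-∈ (≤-trans (Tied.1≤v t) v≤w) (≤-trans (<⇒≤ w<c) (Tied.c≤n t))))
    at' : τ ⟨ posOf τ (suc w) ⟩ ≡ suc w
    at' = proj₁ (posOf-correct τ (suc w) (value-∈ (s≤s z≤n) (≤-trans w<c (Tied.c≤n t))))

  tied⇒descending : ∀ {v c} → Tied v c → ∀ a b → v ≤ a → a < b → b ≤ c → posOf τ b < posOf τ a
  tied⇒descending t a (suc b) v≤a a<b+1 b+1≤c with a ≟ b
  ... | yes refl = tied⇒step-down t a v≤a b+1≤c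
  ... | no a≢b = <-trans (tied⇒step-down t b (≤-trans v≤a (≤-pred a<b+1)) b+1≤c)
                         (tied⇒descending t a b v≤a (≤∧≢⇒< (≤-pred a<b+1) a≢b) (≤-trans (n≤1+n b) b+1≤c))

  tied-positions : ∀ {p q} → 1 ≤ p → p ≤ length τ → 1 ≤ q → q ≤ length τ →
    τ ⟨ p ⟩ < τ ⟨ q ⟩ → nwHeight σ (τ ⟨ p ⟩) ≡ nwHeight σ (τ ⟨ q ⟩) → q < p
  tied-positions 1≤p p≤ 1≤q q≤ lt eq =
    subst₂ _<_ (posOf-τ 1≤q q≤) (posOf-τ 1≤p p≤)
      (tied⇒descending tie _ _ ≤-refl lt ≤-refl)
    where
    tie : Tied _ _
    tie = record { 1≤v = proj₁ (value-bounds 1≤p p≤) ; c≤n = proj₂ (value-bounds 1≤q q≤) ; same = eq }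

  module Hooks (H : List Hook) (vh : IsVHC τ H) where
    open IsVHC vh

    1≤sw : ∀ {i j} → (i , j) ∈ H → 1 ≤ i
    1≤sw h = proj₁ (valid _ h)
    sw<ne : ∀ {i j} → (i , j) ∈ H → i < j
    sw<ne h = proj₁ (proj₂ (valid _ h))
    ne≤ : ∀ {i j} → (i , j) ∈ H → j ≤ length τ
    ne≤ h = proj₁ (proj₂ (proj₂ (valid _ h)))
    rises : ∀ {i j} → (i , j) ∈ H → τ ⟨ i ⟩ < τ ⟨ j ⟩
    rises h = proj₁ (proj₂ (proj₂ (proj₂ (valid _ h))))
    unobstructed : ∀ {i j} → (i , j) ∈ H → ∀ k → i < k → k < j → ¬ (τ ⟨ j ⟩ < τ ⟨ k ⟩)
    unobstructed h = proj₂ (proj₂ (proj₂ (proj₂ (valid _ h))))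

    1≤ne : ∀ {i j} → (i , j) ∈ H → 1 ≤ j
    1≤ne h = ≤-trans (1≤sw h) (<⇒≤ (sw<ne h))
    sw≤ : ∀ {i j} → (i , j) ∈ H → i ≤ length τ
    sw≤ h = ≤-trans (<⇒≤ (sw<ne h)) (ne≤ h)

    descent-of-hook : ∀ {i j} → (i , j) ∈ H → DescentTop τ i
    descent-of-hook h = Equivalence.from (swDescent _) (_ , h)

    hook-of-descent : ∀ {i} → DescentTop τ i → ∃ λ j → (i , j) ∈ H
    hook-of-descent = Equivalence.to (swDescent _)

    -- Two hooks from the same point would share the vertical point (2i, 2τ_i + 1).
    one-hook-per-descent : ∀ {i j j'} → (i , j) ∈ H → (i , j') ∈ H → j ≡ j'
    one-hook-per-descent {i} {j} {j'} h h' with j ≟ j'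
    ... | yes j≡j' = j≡j'
    ... | no j≢j' = ⊥-elim (notEnd (proj₁ (meetEnds _ _ h h' (λ e → j≢j' (cong proj₂ e)) p on-h on-h')))
      where
      p = (2 * i , suc (2 * τ ⟨ i ⟩))
      on-h : OnHook τ (i , j) p
      on-h = inj₁ (refl , n≤1+n _ , 2*-<-odd (rises h))
      on-h' : OnHook τ (i , j') p
      on-h' = inj₁ (refl , n≤1+n _ , 2*-<-odd (rises h'))
      notEnd : IsEndpoint τ (i , j) p → ⊥
      notEnd (inj₁ e) = odd≢even (τ ⟨ i ⟩) (τ ⟨ i ⟩) (cong proj₂ e)
      notEnd (inj₂ e) = odd≢even (τ ⟨ i ⟩) (τ ⟨ j ⟩) (cong proj₂ e)

    -- A hook (i', j') starting strictly inside the horizontal part of (i, j)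
    -- and ending at or after j would cross it at (2i', 2τ_j).
    no-crossing : ∀ {i j i' j'} → (i , j) ∈ H → (i' , j') ∈ H → i < i' → i' < j → j ≤ j' → ⊥
    no-crossing {i} {j} {i'} {j'} h h' i<i' i'<j j≤j' =
      notEnd (proj₁ (meetEnds _ _ h h' (λ e → <-irrefl (cong proj₁ e) i<i') p on-h on-h'))
      where
      p = (2 * i' , 2 * τ ⟨ j ⟩)
      on-h : OnHook τ (i , j) p
      on-h = inj₂ (refl , *-monoʳ-≤ 2 (<⇒≤ i<i') , *-monoʳ-≤ 2 (<⇒≤ i'<j))
      τj≤τj' : τ ⟨ j ⟩ ≤ τ ⟨ j' ⟩
      τj≤τj' with m≤n⇒m<n∨m≡n j≤j'
      ... | inj₂ refl = ≤-refl
      ... | inj₁ j<j' = ≮⇒≥ (unobstructed h' j i'<j j<j')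
      on-h' : OnHook τ (i' , j') p
      on-h' = inj₁ (refl , *-monoʳ-≤ 2 (≮⇒≥ (unobstructed h i' i<i' i'<j)) , *-monoʳ-≤ 2 τj≤τj')
      notEnd : IsEndpoint τ (i , j) p → ⊥
      notEnd (inj₁ e) = <-irrefl (sym (*-cancelˡ-≡ i' i 2 (cong proj₁ e))) i<i'
      notEnd (inj₂ e) = <-irrefl (*-cancelˡ-≡ i' j 2 (cong proj₁ e)) i'<j

  CoveredBy : List Hook → List Hook → Set
  CoveredBy B A = ∀ {i j} → (i , j) ∈ B →
    ∃ λ i₂ → ∃ λ y → (i₂ , y) ∈ A × nwHeight σ (τ ⟨ y ⟩) ≡ nwHeight σ (τ ⟨ j ⟩)

  image⊆⇒covered : ∀ A B → (∀ q → q ∈ hookImage τ B → q ∈ hookImage τ A) → CoveredBy B A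
  image⊆⇒covered A B image⊆ {i} {j} h
    with ∈-map⁻ _ (image⊆ _ (∈-map⁺ (λ P → nw σ (swlPt σ P)) (∈-map⁺ (λ h → (proj₂ h , τ ⟨ proj₂ h ⟩)) h)))
  ... | P , P∈ , eq with ∈-map⁻ _ P∈
  ...   | (i₂ , y) , h₂ , refl = i₂ , y , h₂ , sym (cong proj₂ eq)

  module NoShorterHook (A B : List Hook) (vA : IsVHC τ A) (vB : IsVHC τ B)
    {i J J' i₂ y} (hA : (i , J) ∈ A) (hB : (i , J') ∈ B) (J'<J : J' < J)
    (agreeRight : ∀ {i' x} → i < i' → (i' , x) ∈ A → (i' , x) ∈ B)
    (hA₂ : (i₂ , y) ∈ A) (tie : nwHeight σ (τ ⟨ y ⟩) ≡ nwHeight σ (τ ⟨ J' ⟩)) where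

    module HA = Hooks A vA
    module HB = Hooks B vB

    -- y = J': the hook (i₂, J') collides with (i, J) or (i, J').
    same-endpoint : τ ⟨ y ⟩ ≡ τ ⟨ J' ⟩ → ⊥
    same-endpoint eq = bySource (<-cmp i₂ i)
      where
      y≡J' : y ≡ J'
      y≡J' = τ-injective (HA.1≤ne hA₂) (HA.ne≤ hA₂) (HB.1≤ne hB) (HB.ne≤ hB) eq
      hA₂' : (i₂ , J') ∈ A
      hA₂' = subst (λ z → (i₂ , z) ∈ A) y≡J' hA₂
      bySource : Tri (i₂ < i) (i₂ ≡ i) (i < i₂) → ⊥
      bySource (tri< i₂<i _ _) = HA.no-crossing hA₂' hA i₂<i (HB.sw<ne hB) (<⇒≤ J'<J)
      bySource (tri≈ _ refl _) = <-irrefl (sym (HA.one-hook-per-descent hA hA₂')) J'<J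
      bySource (tri> _ _ i<i₂) = HB.no-crossing hB (agreeRight i<i₂ hA₂') i<i₂ (HA.sw<ne hA₂') ≤-refl

    -- τ_y < τ_J': then J' < y, and τ_i, τ_J', τ_y form a 132 or τ_i ties in.
    lower-endpoint : τ ⟨ y ⟩ < τ ⟨ J' ⟩ → ⊥
    lower-endpoint lt = byHeight (<-cmp (τ ⟨ i ⟩) (τ ⟨ y ⟩))
      where
      J'<y : J' < y
      J'<y = tied-positions (HA.1≤ne hA₂) (HA.ne≤ hA₂) (HB.1≤ne hB) (HB.ne≤ hB) lt tie
      byHeight : Tri (τ ⟨ i ⟩ < τ ⟨ y ⟩) (τ ⟨ i ⟩ ≡ τ ⟨ y ⟩) (τ ⟨ y ⟩ < τ ⟨ i ⟩) → ⊥
      byHeight (tri< τi<τy _ _) = av i J' y (HB.1≤sw hB) (HB.sw<ne hB) J'<y (HA.ne≤ hA₂) (τi<τy , lt)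
      byHeight (tri≈ _ τi≡τy _) =
        <-irrefl (τ-injective (HB.1≤sw hB) (HB.sw≤ hB) (HA.1≤ne hA₂) (HA.ne≤ hA₂) τi≡τy) (<-trans (HB.sw<ne hB) J'<y)
      byHeight (tri> _ _ τy<τi) = <-asym (HB.sw<ne hB)
        (subst₂ _<_ (posOf-τ (HB.1≤ne hB) (HB.ne≤ hB)) (posOf-τ (HB.1≤sw hB) (HB.sw≤ hB))
          (tied⇒descending tied (τ ⟨ i ⟩) (τ ⟨ J' ⟩) (<⇒≤ τy<τi) (HB.rises hB) ≤-refl))
        where
        tied : Tied (τ ⟨ y ⟩) (τ ⟨ J' ⟩)
        tied = record { 1≤v = proj₁ (value-bounds (HA.1≤ne hA₂) (HA.ne≤ hA₂))
                      ; c≤n = proj₂ (value-bounds (HB.1≤ne hB) (HB.ne≤ hB)) ; same = tie }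

    -- τ_J' < τ_y: then y < J', and condition (ii), the rise of (i, J') or
    -- 132-avoidance at i₂, y, J' is violated.
    higher-endpoint : τ ⟨ J' ⟩ < τ ⟨ y ⟩ → ⊥
    higher-endpoint lt = byPos (<-cmp y i)
      where
      y<J' : y < J'
      y<J' = tied-positions (HB.1≤ne hB) (HB.ne≤ hB) (HA.1≤ne hA₂) (HA.ne≤ hA₂) lt (sym tie)
      tied : Tied (τ ⟨ J' ⟩) (τ ⟨ y ⟩)
      tied = record { 1≤v = proj₁ (value-bounds (HB.1≤ne hB) (HB.ne≤ hB))
                    ; c≤n = proj₂ (value-bounds (HA.1≤ne hA₂) (HA.ne≤ hA₂)) ; same = sym tie }
      byHeight : Tri (τ ⟨ i₂ ⟩ < τ ⟨ J' ⟩) (τ ⟨ i₂ ⟩ ≡ τ ⟨ J' ⟩) (τ ⟨ J' ⟩ < τ ⟨ i₂ ⟩) → ⊥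
      byHeight (tri< τi₂<τJ' _ _) = av i₂ y J' (HA.1≤sw hA₂) (HA.sw<ne hA₂) y<J' (HB.ne≤ hB) (τi₂<τJ' , lt)
      byHeight (tri≈ _ τi₂≡τJ' _) =
        <-irrefl (τ-injective (HA.1≤sw hA₂) (HA.sw≤ hA₂) (HB.1≤ne hB) (HB.ne≤ hB) τi₂≡τJ') (<-trans (HA.sw<ne hA₂) y<J')
      byHeight (tri> _ _ τJ'<τi₂) = <-asym (HA.sw<ne hA₂)
        (subst₂ _<_ (posOf-τ (HA.1≤ne hA₂) (HA.ne≤ hA₂)) (posOf-τ (HA.1≤sw hA₂) (HA.sw≤ hA₂))
          (tied⇒descending tied (τ ⟨ i₂ ⟩) (τ ⟨ y ⟩) (<⇒≤ τJ'<τi₂) (HA.rises hA₂) ≤-refl))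
      byPos : Tri (y < i) (y ≡ i) (i < y) → ⊥
      byPos (tri< _ _ _) = byHeight (<-cmp (τ ⟨ i₂ ⟩) (τ ⟨ J' ⟩))
      byPos (tri≈ _ refl _) = <-asym lt (HB.rises hB)
      byPos (tri> _ _ i<y) = HB.unobstructed hB y i<y y<J' lt

    impossible : ⊥
    impossible with <-cmp (τ ⟨ y ⟩) (τ ⟨ J' ⟩)
    ... | tri< lt _ _ = lower-endpoint lt
    ... | tri≈ _ eq _ = same-endpoint eq
    ... | tri> _ _ gt = higher-endpoint gt

  -- Two VHCs on τ whose images cover each other have the same hooks; hooks
  -- from the same point are compared by downward induction on that point.
  module Agreement (H H' : List Hook) (vH : IsVHC τ H) (vH' : IsVHC τ H')
    (H'⊑H : CoveredBy H' H) (H⊑H' : CoveredBy H H') where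

    module HH = Hooks H vH
    module HH' = Hooks H' vH'

    -- agree f i: hooks from i coincide (f bounds the number of points right of i).
    agree : ∀ f i → n ∸ i < f → ∀ {J J'} → (i , J) ∈ H → (i , J') ∈ H' → J ≡ J'
    agree (suc f) i bound {J} {J'} h h' = byCmp (<-cmp J J')
      where
      fewer : ∀ {i₂ x} → i < i₂ → i₂ < x → x ≤ length τ → n ∸ i₂ < f
      fewer i<i₂ i₂<x x≤ = <-≤-trans (∸-monoʳ-< i<i₂ (subst (_ ≤_) length-τ (≤-trans (<⇒≤ i₂<x) x≤))) (≤-pred bound)
      toH' : ∀ {i₂ x} → i < i₂ → (i₂ , x) ∈ H → (i₂ , x) ∈ H'
      toH' i<i₂ hx with HH'.hook-of-descent (HH.descent-of-hook hx)
      ... | x' , hx' = subst (λ z → (_ , z) ∈ H') (sym (agree f _ (fewer i<i₂ (HH.sw<ne hx) (HH.ne≤ hx)) hx hx')) hx'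
      toH : ∀ {i₂ x} → i < i₂ → (i₂ , x) ∈ H' → (i₂ , x) ∈ H
      toH i<i₂ hx with HH.hook-of-descent (HH'.descent-of-hook hx)
      ... | x' , hx' = subst (λ z → (_ , z) ∈ H) (agree f _ (fewer i<i₂ (HH'.sw<ne hx) (HH'.ne≤ hx)) hx' hx) hx'
      byCmp : Tri (J < J') (J ≡ J') (J' < J) → J ≡ J'
      byCmp (tri≈ _ J≡J' _) = J≡J'
      byCmp (tri> _ _ J'<J) with H'⊑H h'
      ... | _ , _ , h₂ , tie = ⊥-elim (NoShorterHook.impossible H H' vH vH' h h' J'<J toH' h₂ tie)
      byCmp (tri< J<J' _ _) with H⊑H' h
      ... | _ , _ , h₂ , tie = ⊥-elim (NoShorterHook.impossible H' H vH' vH h' h J<J' toH h₂ tie)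

    -- Every hook of one configuration starts at a descent top, where the
    -- other has a hook too, and the two end at the same point.
    same-hooks : ∀ h → (h ∈ H) ⇔ (h ∈ H')
    same-hooks (i , j) = mk⇔ to from
      where
      to : (i , j) ∈ H → (i , j) ∈ H'
      to h with HH'.hook-of-descent (HH.descent-of-hook h)
      ... | j' , h' = subst (λ z → (i , z) ∈ H') (sym (agree (suc (n ∸ i)) i ≤-refl h h')) h'
      from : (i , j) ∈ H' → (i , j) ∈ H
      from h' with HH.hook-of-descent (HH'.descent-of-hook h')
      ... | j' , h = subst (λ z → (i , z) ∈ H) (agree (suc (n ∸ i)) i ≤-refl h h') h

  hooks-determined : ∀ H H' → IsVHC τ H → IsVHC τ H' →
    (∀ q → (q ∈ hookImage τ H) ⇔ (q ∈ hookImage τ H')) → ∀ h → (h ∈ H) ⇔ (h ∈ H')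
  hooks-determined H H' vH vH' same-image = Agreement.same-hooks H H' vH vH'
    (image⊆⇒covered H H' (λ q → Equivalence.from (same-image q)))
    (image⊆⇒covered H' H (λ q → Equivalence.to (same-image q)))

proposition6p9 : ∀ n (c c' : VHC132 n) → 𝔚 c ≈ᴾ 𝔚 c' → c ≈ᵛ c'
proposition6p9 n c c' (swl≡ , image⇔) = τ≡τ' , sameHooks τ≡τ' C'.hooks C'.isVHC image⇔
  where
  open VHC132 c
  module C' = VHC132 c'
  τ≡τ' : perm ≡ C'.perm
  τ≡τ' = swl-injective n perm C'.perm isPerm C'.isPerm (avoids132ˢ avoids) (avoids132ˢ C'.avoids)
    (subst₂ (λ k k' → swlUpTo k perm ≡ swlUpTo k' C'.perm) (perm-length isPerm) (perm-length C'.isPerm) swl≡)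
  sameHooks : ∀ {τ'} → perm ≡ τ' → ∀ H' → IsVHC τ' H' →
    (∀ q → (q ∈ hookImage perm hooks) ⇔ (q ∈ hookImage τ' H')) →
    ∀ h → (h ∈ hooks) ⇔ (h ∈ H')
  sameHooks refl H' vH' = HookRecovery.hooks-determined n perm isPerm avoids hooks H' isVHC vH'
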